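{- For positive integers $t_1,t_2$, $$N(P_{t_1}\square P_{t_2})\leq 2\lceil\log_2 (t_1t_2)\rceil+2.$$
   Context: $P_t$ is the path on $t$ vertices. $G\square H$ is the Cartesian product: vertex set $V(G)\times V(H)$, with $(u,u')\sim(v,v')$ iff either $u=v$ and $u'v'\in E(H)$, or $u'=v'$ and $uv\in E(G)$. For a graph $G$, a covering of $G$ is a collection of subsets $A_1,\ldots,A_k$ of $V(G)$ such that for every edge $\{u,v\}$ and every vertex $x\notin\{u,v\}$ there is some $A_j$ with $\{u,v\}\subseteq A_j$ and $x\notin A_j$; $N(G)$ is the minimum size of a covering of $G$. -}

module Defs where

open import Level using (0ℓ)
open import Data.Nat using (ℕ; suc; _≤_)
open import Data.Fin using (Fin; toℕ)
open import Data.Bool using (Bool; true; false)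
open import Data.Product using (_×_; _,_; Σ; ∃-syntax)
open import Data.Sum using (_⊎_)
open import Relation.Binary.PropositionalEquality using (_≡_; _≢_)

record Graph : Set₁ where
  field
    V   : Set
    Adj : V → V → Set
open Graph public

P : ℕ → Graph
P t = record
  { V = Fin t
  ; Adj = λ i j → (toℕ j ≡ suc (toℕ i)) ⊎ (toℕ i ≡ suc (toℕ j)) }

_□_ : Graph → Graph → Graph
G □ H = record
  { V = V G × V H
  ; Adj = λ { (u , u') (v , v') →
        ((u ≡ v) × Adj H u' v') ⊎ ((u' ≡ v') × Adj G u v) } }

Subset : Graph → Set
Subset G = V G → Bool

IsCovering : (G : Graph) (k : ℕ) → (Fin k → Subset G) → Set
IsCovering G k A =
  ∀ (u v x : V G) → Adj G u v → x ≢ u → x ≢ v →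
    ∃[ j ] ((A j u ≡ true) × (A j v ≡ true) × (A j x ≡ false))

-- "N(G) ≤ m": there is a covering of G of size at most m
-- (equivalent to the minimum size N(G) being at most m).
N≤ : Graph → ℕ → Set
N≤ G m = ∃[ k ] ((k ≤ m) × Σ (Fin k → Subset G) (IsCovering G k))

-- Give every vertex of P_t the m-bit reflected Gray code of its index, where t ≤ 2^m: distinct
-- vertices get distinct codes, and the codes of adjacent vertices differ in at most one bit.
-- Consequently, for an edge uv and a vertex x ∉ {u,v}, some bit is shared by u and v but not by x.
-- On P_{t₁} □ P_{t₂} concatenate the codes of the two coordinates; the same property holds, since
-- for an edge in one direction either x differs from the edge in the other coordinate, or x lies
-- on the same path as the edge. For every bit, the vertices where it is 1 and those where it is 0
-- then form a covering of size 2(m₁ + m₂), and with m_i = ⌈log₂ t_i⌉ one has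
-- m₁ + m₂ ≤ ⌈log₂ (t₁ t₂)⌉ + 1.
module Submission where

open import Defs
open import Data.Nat using (ℕ; _+_; _*_; _≤_)
open import Data.Nat.Logarithm using (⌈log₂_⌉)

open import Data.Bool using (Bool; true; false; not; _xor_)
open import Data.Bool.Properties
  using (not-injective; not-involutive; not-¬; ¬-not) renaming (_≟_ to _≟ᵇ_)
open import Data.Empty using (⊥-elim)
open import Data.Fin using (Fin; zero; suc; toℕ; _↑ˡ_; _↑ʳ_)
open import Data.Fin.Properties using (toℕ<n; toℕ-injective; ¬∀⟶∃¬) renaming (_≟_ to _≟ᶠ_)
open import Data.Nat using (zero; suc; _<_; _^_; ⌊_/2⌋; ⌈_/2⌉; NonZero; z≤n; s≤s)
open import Data.Nat.Logarithm
  using (⌈log₂⌉-mono-≤; ⌈log₂⌈n/2⌉⌉≡⌈log₂n⌉∸1; ⌈log₂2*n⌉≡1+⌈log₂n⌉; ⌈log₂2^n⌉≡n)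
open import Data.Nat.Properties
  using ( ≤-refl; ≤-trans; ≤-pred; <-irrefl; <⇒≱; ≰⇒>; suc-injective; +-mono-≤; +-monoˡ-≤
        ; +-identityʳ; ∸-monoˡ-≤; *-mono-<; ^-distribˡ-+-*; m*n≢0
        ; ⌊n/2⌋≤⌈n/2⌉; ⌊n/2⌋+⌈n/2⌉≡n; ⌈n/2⌉-mono; n≡⌈n+n/2⌉; module ≤-Reasoning)
open import Data.Nat.Tactic.RingSolver using (solve-∀)
open import Data.Product using (_×_; _,_; ∃-syntax)
open import Data.Sum using (_⊎_; inj₁; inj₂)
open import Data.Vec.Functional using (Vector; _++_; map)
open import Data.Vec.Functional.Properties using (lookup-++ˡ; lookup-++ʳ)
open import Function using (_∘_)
open import Relation.Binary.Definitions using (DecidableEquality)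
open import Relation.Binary.PropositionalEquality
open import Relation.Nullary using (yes; no; contradiction)

Code : Graph → ℕ → Set
Code G m = V G → Vector Bool m

Separates : ∀ {m} → Vector Bool m → Vector Bool m → Vector Bool m → Fin m → Set
Separates p q r i = p i ≡ q i × r i ≢ p i

IsSeparating : ∀ {A : Set} {m} → (A → Vector Bool m) → Set
IsSeparating f = ∀ {x y} → x ≢ y → ∃[ i ] f x i ≢ f y i

IsEdgeSeparating : ∀ {m} (G : Graph) → Code G m → Set
IsEdgeSeparating G f =
  ∀ {u v x} → Adj G u v → x ≢ u → x ≢ v → ∃[ i ] Separates (f u) (f v) (f x) i

AtMostOneBitApart : ∀ {m} → Vector Bool m → Vector Bool m → Set
AtMostOneBitApart p q = ∀ {i j} → i ≢ j → p i ≡ q i ⊎ p j ≡ q j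

atMostOneBitApart-sym : ∀ {m} {p q : Vector Bool m} →
  AtMostOneBitApart p q → AtMostOneBitApart q p
atMostOneBitApart-sym p~q i≢j with p~q i≢j
... | inj₁ pᵢ≡qᵢ = inj₁ (sym pᵢ≡qᵢ)
... | inj₂ pⱼ≡qⱼ = inj₂ (sym pⱼ≡qⱼ)

withComplement : ∀ {m} → Vector Bool m → Vector Bool (m + m)
withComplement p = p ++ map not p

withComplement-selects : ∀ {m} (p q r : Vector Bool m) {i} b →
  p i ≡ b → q i ≡ b → r i ≡ not b →
  ∃[ j ] (withComplement p j ≡ true × withComplement q j ≡ true × withComplement r j ≡ false)
withComplement-selects {m} p q r {i} true pᵢ qᵢ rᵢ =
  i ↑ˡ m , trans (lookup-++ˡ p _ i) pᵢ , trans (lookup-++ˡ q _ i) qᵢ , trans (lookup-++ˡ r _ i) rᵢ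
withComplement-selects {m} p q r {i} false pᵢ qᵢ rᵢ =
  m ↑ʳ i , trans (lookup-++ʳ p _ i) (cong not pᵢ) , trans (lookup-++ʳ q _ i) (cong not qᵢ) ,
  trans (lookup-++ʳ r _ i) (cong not rᵢ)

edgeSeparating⇒N≤ : ∀ {G m} {f : Code G m} → IsEdgeSeparating G f → N≤ G (m + m)
edgeSeparating⇒N≤ {m = m} {f} sep =
  m + m , ≤-refl , (λ j w → withComplement (f w) j) ,
  λ u v x adj x≢u x≢v →
    let i , uᵢ≡vᵢ , xᵢ≢uᵢ = sep adj x≢u x≢v in
    withComplement-selects (f u) (f v) (f x) (f u i) refl (sym uᵢ≡vᵢ) (¬-not xᵢ≢uᵢ)

N≤-mono : ∀ {G k m} → k ≤ m → N≤ G k → N≤ G m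
N≤-mono k≤m (n , n≤k , A , covering) = n , ≤-trans n≤k k≤m , A , covering

separating⇒edgeSeparating : ∀ {G m} {f : Code G m} → IsSeparating f →
  (∀ {u v} → Adj G u v → AtMostOneBitApart (f u) (f v)) → IsEdgeSeparating G f
separating⇒edgeSeparating sep steps adj x≢u x≢v with sep x≢u | sep x≢v
... | i , xᵢ≢uᵢ | j , xⱼ≢vⱼ with i ≟ᶠ j
... | yes refl = i , not-injective (trans (sym (¬-not xᵢ≢uᵢ)) (¬-not xⱼ≢vⱼ)) , xᵢ≢uᵢ
... | no i≢j with steps adj i≢j
...   | inj₁ uᵢ≡vᵢ = i , uᵢ≡vᵢ , xᵢ≢uᵢ
...   | inj₂ uⱼ≡vⱼ = j , uⱼ≡vⱼ , λ xⱼ≡uⱼ → xⱼ≢vⱼ (trans xⱼ≡uⱼ uⱼ≡vⱼ)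

_⊗_ : ∀ {A B : Set} {m n} →
  (A → Vector Bool m) → (B → Vector Bool n) → A × B → Vector Bool (m + n)
(f ⊗ g) (a , b) = f a ++ g b

++-separatesˡ : ∀ {m n} (p q r : Vector Bool m) (p' q' r' : Vector Bool n) {i} →
  Separates p q r i → Separates (p ++ p') (q ++ q') (r ++ r') (i ↑ˡ n)
++-separatesˡ p q r p' q' r' {i} s
  rewrite lookup-++ˡ p p' i | lookup-++ˡ q q' i | lookup-++ˡ r r' i = s

++-separatesʳ : ∀ {m n} (p q r : Vector Bool m) (p' q' r' : Vector Bool n) {i} →
  Separates p' q' r' i → Separates (p ++ p') (q ++ q') (r ++ r') (m ↑ʳ i)
++-separatesʳ p q r p' q' r' {i} s
  rewrite lookup-++ʳ p p' i | lookup-++ʳ q q' i | lookup-++ʳ r r' i = s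

□-edgeSeparating : ∀ {G H m n} {f : Code G m} {g : Code H n} →
  DecidableEquality (V G) → DecidableEquality (V H) →
  IsSeparating f → IsEdgeSeparating G f → IsSeparating g → IsEdgeSeparating H g →
  IsEdgeSeparating (G □ H) (f ⊗ g)
□-edgeSeparating {m = m} {n} {f} {g} _≟G_ _≟H_ f-sep f-edge g-sep g-edge
  {u , u'} {_ , v'} {x , x'} (inj₁ (refl , adj)) x≢u x≢v with x ≟G u
... | no x≢u₁ = let i , ne = f-sep x≢u₁ in
  i ↑ˡ n , ++-separatesˡ (f u) (f u) (f x) (g u') (g v') (g x') (refl , ne)
... | yes refl = let i , s = g-edge adj (x≢u ∘ cong (x ,_)) (x≢v ∘ cong (x ,_)) in
  m ↑ʳ i , ++-separatesʳ (f x) (f x) (f x) (g u') (g v') (g x') s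
□-edgeSeparating {m = m} {n} {f} {g} _≟G_ _≟H_ f-sep f-edge g-sep g-edge
  {u , u'} {v , _} {x , x'} (inj₂ (refl , adj)) x≢u x≢v with x' ≟H u'
... | no x'≢u' = let i , ne = g-sep x'≢u' in
  m ↑ʳ i , ++-separatesʳ (f u) (f v) (f x) (g u') (g u') (g x') (refl , ne)
... | yes refl = let i , s = f-edge adj (x≢u ∘ cong (_, x')) (x≢v ∘ cong (_, x')) in
  i ↑ˡ n , ++-separatesˡ (f u) (f v) (f x) (g x') (g x') (g x') s

odd : ℕ → Bool
odd zero    = false
odd (suc n) = not (odd n)

-- Bit i of the Gray code of k is the xor of bits i and i+1 of k (least significant first).
gray : ∀ m → ℕ → Vector Bool m
gray (suc m) k zero    = odd k xor odd ⌊ k /2⌋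
gray (suc m) k (suc i) = gray m ⌊ k /2⌋ i

xor-cancelʳ : ∀ {a a'} b → a xor b ≡ a' xor b → a ≡ a'
xor-cancelʳ {true}  {true}  _ _ = refl
xor-cancelʳ {false} {false} _ _ = refl
xor-cancelʳ {true}  {false} b e = contradiction (sym e) (not-¬ refl)
xor-cancelʳ {false} {true}  b e = contradiction e (not-¬ refl)

not-xor-not : ∀ a b → not a xor not b ≡ a xor b
not-xor-not true  b = refl
not-xor-not false b = not-involutive b

⌊/2⌋-odd-injective : ∀ {k k'} → ⌊ k /2⌋ ≡ ⌊ k' /2⌋ → odd k ≡ odd k' → k ≡ k'
⌊/2⌋-odd-injective {0}           {0}            _ _ = refl
⌊/2⌋-odd-injective {1}           {1}            _ _ = refl
⌊/2⌋-odd-injective {0}           {1}            _ ()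
⌊/2⌋-odd-injective {1}           {0}            _ ()
⌊/2⌋-odd-injective {0}           {suc (suc _)}  () _
⌊/2⌋-odd-injective {1}           {suc (suc _)}  () _
⌊/2⌋-odd-injective {suc (suc _)} {0}            () _
⌊/2⌋-odd-injective {suc (suc _)} {1}            () _
⌊/2⌋-odd-injective {suc (suc k)} {suc (suc k')} h p =
  cong (2 +_) (⌊/2⌋-odd-injective (suc-injective h) (not-injective (not-injective p)))

⌊n/2⌋<m : ∀ {n m} → n < 2 * m → ⌊ n /2⌋ < m
⌊n/2⌋<m {n} {m} n<2m = begin
  ⌈ suc n /2⌉      ≤⟨ ⌈n/2⌉-mono (subst (suc n ≤_) (cong (m +_) (+-identityʳ m)) n<2m) ⟩
  ⌈ m + m /2⌉      ≡⟨ n≡⌈n+n/2⌉ m ⟨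
  m                ∎
  where open ≤-Reasoning

⌊suc/2⌋-cases : ∀ k → ⌊ suc k /2⌋ ≡ ⌊ k /2⌋ ⊎ ⌊ suc k /2⌋ ≡ suc ⌊ k /2⌋
⌊suc/2⌋-cases zero          = inj₁ refl
⌊suc/2⌋-cases (suc zero)    = inj₂ refl
⌊suc/2⌋-cases (suc (suc k)) with ⌊suc/2⌋-cases k
... | inj₁ e = inj₁ (cong suc e)
... | inj₂ e = inj₂ (cong suc e)

gray-injective : ∀ m {k k'} → k < 2 ^ m → k' < 2 ^ m →
  (∀ i → gray m k i ≡ gray m k' i) → k ≡ k'
gray-injective zero    {zero}  {zero}  _ _ _ = refl
gray-injective zero    {suc _} (s≤s ()) _
gray-injective zero    {_} {suc _} _ (s≤s ())
gray-injective (suc m) {k} {k'} k< k'< same = ⌊/2⌋-odd-injective halves parities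
  where
  halves : ⌊ k /2⌋ ≡ ⌊ k' /2⌋
  halves = gray-injective m (⌊n/2⌋<m k<) (⌊n/2⌋<m k'<) (same ∘ suc)
  parities : odd k ≡ odd k'
  parities = xor-cancelʳ (odd ⌊ k' /2⌋)
    (trans (cong (λ h → odd k xor odd h) (sym halves)) (same zero))

gray-head-suc : ∀ m k → ⌊ suc k /2⌋ ≡ suc ⌊ k /2⌋ →
  gray (suc m) k zero ≡ gray (suc m) (suc k) zero
gray-head-suc m k next rewrite next = sym (not-xor-not (odd k) (odd ⌊ k /2⌋))

-- From k to k+1 either ⌊k/2⌋ is unchanged, so only bit 0 can flip, or ⌊k/2⌋ is incremented and
-- both parities in bit 0 flip, so bit 0 is kept and the claim recurses.
gray-suc : ∀ m k → AtMostOneBitApart (gray m k) (gray m (suc k))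
gray-suc (suc m) k {i} {j} i≢j with ⌊suc/2⌋-cases k
gray-suc (suc m) k {zero}  {zero}  i≢j | _ = ⊥-elim (i≢j refl)
gray-suc (suc m) k {suc i} {_}     _   | inj₁ same = inj₁ (cong (λ h → gray m h i) (sym same))
gray-suc (suc m) k {zero}  {suc j} _   | inj₁ same = inj₂ (cong (λ h → gray m h j) (sym same))
gray-suc (suc m) k {zero}  {_}     _   | inj₂ next = inj₁ (gray-head-suc m k next)
gray-suc (suc m) k {suc i} {zero}  _   | inj₂ next = inj₂ (gray-head-suc m k next)
gray-suc (suc m) k {suc i} {suc j} i≢j | inj₂ next
  rewrite next = gray-suc m ⌊ k /2⌋ (i≢j ∘ cong suc)

gray-separating : ∀ {t} m → t ≤ 2 ^ m → IsSeparating (gray m ∘ toℕ {t})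
gray-separating m t≤2^m {x} {y} x≢y =
  ¬∀⟶∃¬ m _ (λ i → gray m (toℕ x) i ≟ᵇ gray m (toℕ y) i)
    (x≢y ∘ toℕ-injective ∘ gray-injective m (bound x) (bound y))
  where
  bound : ∀ z → toℕ z < 2 ^ m
  bound z = ≤-trans (toℕ<n z) t≤2^m

gray-edgeSeparating : ∀ {t} m → t ≤ 2 ^ m → IsEdgeSeparating (P t) (gray m ∘ toℕ)
gray-edgeSeparating {t} m t≤2^m = separating⇒edgeSeparating (gray-separating m t≤2^m) step
  where
  step : ∀ {u v} → Adj (P t) u v → AtMostOneBitApart (gray m (toℕ u)) (gray m (toℕ v))
  step {u} (inj₁ v≡1+u) rewrite v≡1+u = gray-suc m (toℕ u)
  step {v = v} (inj₂ u≡1+v) rewrite u≡1+v = atMostOneBitApart-sym (gray-suc m (toℕ v))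

⌈log₂n⌉≤p⇒n≤2^p : ∀ n p → ⌈log₂ n ⌉ ≤ p → n ≤ 2 ^ p
⌈log₂n⌉≤p⇒n≤2^p zero          _       _  = z≤n
⌈log₂n⌉≤p⇒n≤2^p (suc zero)    zero    _  = ≤-refl
⌈log₂n⌉≤p⇒n≤2^p (suc (suc n)) zero    ()
⌈log₂n⌉≤p⇒n≤2^p n             (suc p) h  = begin
  n                  ≡⟨ ⌊n/2⌋+⌈n/2⌉≡n n ⟨
  ⌊ n /2⌋ + ⌈ n /2⌉  ≤⟨ +-monoˡ-≤ ⌈ n /2⌉ (⌊n/2⌋≤⌈n/2⌉ n) ⟩
  ⌈ n /2⌉ + ⌈ n /2⌉  ≤⟨ +-mono-≤ half≤2^p half≤2^p ⟩
  2 ^ p + 2 ^ p      ≡⟨ cong (2 ^ p +_) (+-identityʳ (2 ^ p)) ⟨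
  2 ^ suc p          ∎
  where
  open ≤-Reasoning
  half≤2^p : ⌈ n /2⌉ ≤ 2 ^ p
  half≤2^p = ⌈log₂n⌉≤p⇒n≤2^p ⌈ n /2⌉ p
    (subst (_≤ p) (sym (⌈log₂⌈n/2⌉⌉≡⌈log₂n⌉∸1 n)) (∸-monoˡ-≤ 1 h))

n≤2^p⇒⌈log₂n⌉≤p : ∀ {n p} → n ≤ 2 ^ p → ⌈log₂ n ⌉ ≤ p
n≤2^p⇒⌈log₂n⌉≤p {p = p} n≤2^p = subst (_ ≤_) (⌈log₂2^n⌉≡n p) (⌈log₂⌉-mono-≤ n≤2^p)

n≤2^⌈log₂n⌉ : ∀ n → n ≤ 2 ^ ⌈log₂ n ⌉
n≤2^⌈log₂n⌉ n = ⌈log₂n⌉≤p⇒n≤2^p n ⌈log₂ n ⌉ ≤-refl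

2^p<n⇒p<⌈log₂n⌉ : ∀ {n p} → 2 ^ p < n → p < ⌈log₂ n ⌉
2^p<n⇒p<⌈log₂n⌉ {n} {p} 2^p<n = ≰⇒> (<⇒≱ 2^p<n ∘ ⌈log₂n⌉≤p⇒n≤2^p n p)

2^⌈log₂n⌉<2*n : ∀ n .{{_ : NonZero n}} → 2 ^ ⌈log₂ n ⌉ < 2 * n
2^⌈log₂n⌉<2*n n = ≰⇒> λ 2n≤2^L →
  <-irrefl refl (subst (_≤ ⌈log₂ n ⌉) (⌈log₂2*n⌉≡1+⌈log₂n⌉ n) (n≤2^p⇒⌈log₂n⌉≤p 2n≤2^L))

⌈log₂⌉-+-≤ : ∀ a b .{{_ : NonZero a}} .{{_ : NonZero b}} →
  ⌈log₂ a ⌉ + ⌈log₂ b ⌉ ≤ suc ⌈log₂ (a * b) ⌉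
⌈log₂⌉-+-≤ a b = ≤-pred (subst (⌈log₂ a ⌉ + ⌈log₂ b ⌉ <_) log₄ab (2^p<n⇒p<⌈log₂n⌉ 2^[A+B]<4ab))
  where
  instance
    ab≢0 : NonZero (a * b)
    ab≢0 = m*n≢0 a b
    2ab≢0 : NonZero (2 * (a * b))
    2ab≢0 = m*n≢0 2 (a * b)
  open ≤-Reasoning
  2^[A+B]<4ab : 2 ^ (⌈log₂ a ⌉ + ⌈log₂ b ⌉) < 2 * (2 * (a * b))
  2^[A+B]<4ab = begin-strict
    2 ^ (⌈log₂ a ⌉ + ⌈log₂ b ⌉)   ≡⟨ ^-distribˡ-+-* 2 ⌈log₂ a ⌉ ⌈log₂ b ⌉ ⟩
    2 ^ ⌈log₂ a ⌉ * 2 ^ ⌈log₂ b ⌉ <⟨ *-mono-< (2^⌈log₂n⌉<2*n a) (2^⌈log₂n⌉<2*n b) ⟩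
    (2 * a) * (2 * b)            ≡⟨ [2a][2b]≡2[2ab] a b ⟩
    2 * (2 * (a * b))            ∎
    where
    [2a][2b]≡2[2ab] : ∀ a b → (2 * a) * (2 * b) ≡ 2 * (2 * (a * b))
    [2a][2b]≡2[2ab] = solve-∀
  log₄ab : ⌈log₂ (2 * (2 * (a * b))) ⌉ ≡ 2 + ⌈log₂ (a * b) ⌉
  log₄ab = trans (⌈log₂2*n⌉≡1+⌈log₂n⌉ (2 * (a * b))) (cong suc (⌈log₂2*n⌉≡1+⌈log₂n⌉ (a * b)))

corollary3p11 : (t₁ t₂ : ℕ) → 1 ≤ t₁ → 1 ≤ t₂ →
    N≤ (P t₁ □ P t₂) (2 * ⌈log₂ (t₁ * t₂) ⌉ + 2)
corollary3p11 t₁ t₂ (s≤s z≤n) (s≤s z≤n) =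
  N≤-mono size-bound (edgeSeparating⇒N≤ grid-edgeSeparating)
  where
  m₁ m₂ L : ℕ
  m₁ = ⌈log₂ t₁ ⌉
  m₂ = ⌈log₂ t₂ ⌉
  L  = ⌈log₂ (t₁ * t₂) ⌉

  grid-edgeSeparating : IsEdgeSeparating (P t₁ □ P t₂) ((gray m₁ ∘ toℕ) ⊗ (gray m₂ ∘ toℕ))
  grid-edgeSeparating = □-edgeSeparating _≟ᶠ_ _≟ᶠ_
    (gray-separating m₁ (n≤2^⌈log₂n⌉ t₁)) (gray-edgeSeparating m₁ (n≤2^⌈log₂n⌉ t₁))
    (gray-separating m₂ (n≤2^⌈log₂n⌉ t₂)) (gray-edgeSeparating m₂ (n≤2^⌈log₂n⌉ t₂))

  size-bound : (m₁ + m₂) + (m₁ + m₂) ≤ 2 * L + 2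
  size-bound = subst ((m₁ + m₂) + (m₁ + m₂) ≤_) (double-suc L)
    (+-mono-≤ (⌈log₂⌉-+-≤ t₁ t₂) (⌈log₂⌉-+-≤ t₁ t₂))
    where
    double-suc : ∀ L → suc L + suc L ≡ 2 * L + 2
    double-suc = solve-∀
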